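{- Let $a\in\mathbb N$ and consider the infinite Jaco graph $J_\infty(a)$. For every $n\in\mathbb N$ the following hold: (a) $d^+(v_n)+d^-(v_n)=an$; (b) $d^-(v_{n+1})\in\{d^-(v_n),\,d^-(v_n)+1\}$; (c) if $(v_i,v_k)\in E(J_\infty(a))$ and $i<j<k$, then $(v_j,v_k)\in E(J_\infty(a))$; (d) $d^+(v_n)=(a-1)n+c_{a,n}$.
   Context: $\mathbb N=\{1,2,3,\dots\}$, $\mathbb N_0=\mathbb N\cup\{0\}$. For $a\in\mathbb N$, the infinite Jaco graph $J_\infty(a)$ is the directed graph with vertex set $\{v_i: i\in\mathbb N\}$ in which every arc has the form $(v_i,v_j)$ with $i<j$, and for $i<j$, $(v_i,v_j)$ is an arc if and only if $(a+1)i-d^-(v_i)\ge j$. Here $d^-(v_i)$ is the in-degree of $v_i$; since all arcs into $v_i$ come from vertices $v_h$ with $h<i$, this determines the arc set recursively. $d^+(v_n)$ denotes the out-degree of $v_n$. The sequence $(c_{a,n})_{n\in\mathbb N_0}$ is defined by $c_{a,0}=0$, $c_{a,1}=1$, and $c_{a,n}=\min\{k<n : ak+c_{a,k}\ge n\}$ for $n\ge 2$. -}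

module Defs where

open import Data.Nat using (ℕ; zero; suc; _+_; _*_; _∸_; _≤ᵇ_; _<ᵇ_; _≡ᵇ_)
open import Data.Bool using (Bool; true; false; if_then_else_; _∧_)
open import Relation.Binary.PropositionalEquality using (_≡_)

count : (ℕ → Bool) → ℕ → ℕ
count p zero    = 0
count p (suc n) = (if p (suc n) then 1 else 0) + count p n

-- least k < n with p k ≡ true, or n if there is none
least : (ℕ → Bool) → ℕ → ℕ
least p zero    = 0
least p (suc n) with least p n <ᵇ n
... | true  = least p n
... | false = if p n then n else suc n

-- Course-of-values computation of in-degrees of J_∞(a).
-- indegTable a n i = d⁻(v_i) for 1 ≤ i ≤ n (and 0 for i > n).
-- d⁻(v_{n+1}) = #{ h ∈ {1..n} : (a+1)h − d⁻(v_h) ≥ n+1 }.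
indegTable : ℕ → ℕ → ℕ → ℕ
indegTable a zero    i = 0
indegTable a (suc n) i =
  if i ≤ᵇ n then indegTable a n i
  else count (λ h → suc n ≤ᵇ (suc a * h ∸ indegTable a n h)) n

indeg : ℕ → ℕ → ℕ
indeg a i = indegTable a i i

isArc : ℕ → ℕ → ℕ → Bool
isArc a i j = (1 ≤ᵇ i) ∧ ((i <ᵇ j) ∧ (j ≤ᵇ (suc a * i ∸ indeg a i)))

Arc : ℕ → ℕ → ℕ → Set
Arc a i j = isArc a i j ≡ true

-- out-degree d⁺(v_n): number of j with (v_n , v_j) an arc.
-- Every arc (v_n , v_j) satisfies j ≤ (a+1)n by definition, so counting
-- over j ∈ {1,…,(a+1)n} counts all out-neighbours.
outdeg : ℕ → ℕ → ℕ
outdeg a n = count (λ j → isArc a n j) (suc a * n)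

-- c_{a,n}: c_{a,0}=0, c_{a,1}=1, c_{a,n} = min{k<n : a k + c_{a,k} ≥ n} (n ≥ 2)
-- cTable a n k = c_{a,k} for k ≤ n.
cTable : ℕ → ℕ → ℕ → ℕ
cTable a zero    k = 0
cTable a (suc n) k =
  if k ≤ᵇ n then cTable a n k
  else (if n ≡ᵇ 0 then 1
        else least (λ m → suc n ≤ᵇ (a * m + cTable a n m)) (suc n))

c : ℕ → ℕ → ℕ
c a n = cTable a n n

-- Let reach(h) = (a+1)h − d⁻(v_h), the index of the last out-neighbour of v_h; then
-- d⁻(v_{n+1}) counts the h ≤ n with reach(h) ≥ n+1. Comparing this with the count for
-- d⁻(v_n), d⁻ grows by at most one per step, hence reach(h+1) ≥ reach(h) + a: reach is
-- increasing, strictly as a ≥ 1. Monotonicity gives (c), and strictness gives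
-- d⁻(v_n) ≤ d⁻(v_{n+1}) since reach(h) ≥ n implies reach(h+1) ≥ n+1; this proves (b).
-- The out-neighbours of v_n are v_{n+1},…,v_{reach(n)}, so d⁺(v_n) = reach(n) − n.
-- By strong induction a k + c_{a,k} = reach(k), so c_{a,n} is the least k with
-- reach(k) ≥ n; those k < n form a final segment of size d⁻(v_n), so
-- c_{a,n} + d⁻(v_n) = n, which gives (d) and then (a).
module Submission where

open import Data.Bool using (Bool; true; false; if_then_else_; _∧_; T)
open import Data.Bool.Properties using (T-≡; T-∧; ∧-identityʳ; ∧-zeroʳ)
open import Data.Empty using (⊥-elim)
open import Data.Nat using (ℕ; zero; suc; _+_; _*_; _∸_; _≤_; _<_; _≤ᵇ_; _<ᵇ_; z≤n; s≤s)
open import Data.Nat.Induction using (<-rec)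
open import Data.Nat.Properties
open import Data.Product using (_×_; _,_; proj₂)
open import Data.Sum using (_⊎_; inj₁; inj₂)
open import Function using (_∘_)
open import Function.Bundles using (Equivalence)
open import Relation.Nullary using (¬_; contradiction; yes; no)
open import Relation.Nullary.Reflects using (ofʸ; ofⁿ)
open import Relation.Binary.PropositionalEquality

open import Defs

open Equivalence using (to; from)

if-T : ∀ {A : Set} {b} {x y : A} → T b → (if b then x else y) ≡ x
if-T {b = true} _ = refl

if-¬T : ∀ {A : Set} {b} {x y : A} → ¬ T b → (if b then x else y) ≡ y
if-¬T {b = true}  ¬t = ⊥-elim (¬t _)
if-¬T {b = false} _  = refl

¬T⇒≡false : ∀ {b} → ¬ T b → b ≡ false
¬T⇒≡false {true}  ¬t = ⊥-elim (¬t _)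
¬T⇒≡false {false} _  = refl

1+n≰ᵇn : ∀ n → ¬ T (suc n ≤ᵇ n)
1+n≰ᵇn n = 1+n≰n ∘ ≤ᵇ⇒≤ (suc n) n

count-cong : ∀ {p q : ℕ → Bool} n → (∀ {h} → h ≤ n → p h ≡ q h) → count p n ≡ count q n
count-cong zero    _  = refl
count-cong (suc n) eq =
  cong₂ (λ b m → (if b then 1 else 0) + m) (eq ≤-refl) (count-cong n (eq ∘ m≤n⇒m≤1+n))

count-mono : ∀ (p q : ℕ → Bool) → (∀ h → T (p h) → T (q h)) → ∀ n → count p n ≤ count q n
count-mono p q p⇒q zero    = z≤n
count-mono p q p⇒q (suc n) = +-mono-≤ (indicator-mono (p⇒q (suc n))) (count-mono p q p⇒q n)
  where
  indicator-mono : ∀ {b c} → (T b → T c) → (if b then 1 else 0) ≤ (if c then 1 else 0)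
  indicator-mono {false}         _   = z≤n
  indicator-mono {true} {true}   _   = ≤-refl
  indicator-mono {true} {false} b⇒c = ⊥-elim (b⇒c _)

count-suc-≤ : ∀ p n → count p (suc n) ≤ suc (count p n)
count-suc-≤ p n with p (suc n)
... | true  = ≤-refl
... | false = n≤1+n (count p n)

count-≤ : ∀ p n → count p n ≤ n
count-≤ p zero    = z≤n
count-≤ p (suc n) = ≤-trans (count-suc-≤ p n) (s≤s (count-≤ p n))

count-shift : ∀ (p : ℕ → Bool) n → count (p ∘ suc) n ≤ count p (suc n)
count-shift p zero    = z≤n
count-shift p (suc n) = +-monoʳ-≤ (if p (suc (suc n)) then 1 else 0) (count-shift p n)

count-none : ∀ {p} n → (∀ {h} → h ≤ n → ¬ T (p h)) → count p n ≡ 0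
count-none zero    _    = refl
count-none (suc n) none = cong₂ _+_ (if-¬T (none ≤-refl)) (count-none n (none ∘ m≤n⇒m≤1+n))

count-∧-≤ᵇ : ∀ p {F} M → F ≤ M → count (λ j → p j ∧ (j ≤ᵇ F)) M ≡ count p F
count-∧-≤ᵇ p zero    z≤n = refl
count-∧-≤ᵇ p {F} (suc M) F≤1+M with m≤n⇒m<n∨m≡n F≤1+M
... | inj₂ refl =
  count-cong (suc M) (λ {j} j≤F → trans (cong (p j ∧_) (to T-≡ (≤⇒≤ᵇ j≤F))) (∧-identityʳ (p j)))
... | inj₁ (s≤s F≤M) =
  cong₂ _+_ (cong (λ b → if b then 1 else 0) (trans (cong (p (suc M) ∧_) 1+M≰ᵇF) (∧-zeroʳ (p (suc M)))))
            (count-∧-≤ᵇ p M F≤M)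
  where
  1+M≰ᵇF : (suc M ≤ᵇ F) ≡ false
  1+M≰ᵇF = ¬T⇒≡false (<⇒≱ (s≤s F≤M) ∘ ≤ᵇ⇒≤ (suc M) F)

count-<ᵇ : ∀ n F → count (n <ᵇ_) F ≡ F ∸ n
count-<ᵇ n zero = sym (0∸n≡0 n)
count-<ᵇ n (suc F) with n ≤? F
... | yes n≤F =
  trans (cong₂ _+_ (if-T (<⇒<ᵇ (s≤s n≤F))) (count-<ᵇ n F)) (sym (+-∸-assoc 1 n≤F))
... | no n≰F  =
  trans (cong₂ _+_ (if-¬T (n≰F ∘ ≤-pred ∘ <ᵇ⇒< n (suc F))) (count-<ᵇ n F))
        (trans (m≤n⇒m∸n≡0 (<⇒≤ (≰⇒> n≰F))) (sym (m≤n⇒m∸n≡0 (≰⇒> n≰F))))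

least-suc : ∀ p n → least p (suc n) ≡ (if least p n <ᵇ n then least p n else (if p n then n else suc n))
least-suc p n with least p n <ᵇ n
... | true  = refl
... | false = refl

least-cong : ∀ {p q : ℕ → Bool} n → (∀ {k} → k < n → p k ≡ q k) → least p n ≡ least q n
least-cong zero _ = refl
least-cong {p} {q} (suc n) eq = begin
    least p (suc n)
  ≡⟨ least-suc p n ⟩
    (if least p n <ᵇ n then least p n else (if p n then n else suc n))
  ≡⟨ cong₂ (λ l b → if l <ᵇ n then l else (if b then n else suc n))
           (least-cong n (eq ∘ m<n⇒m<1+n)) (eq (n<1+n n)) ⟩
    (if least q n <ᵇ n then least q n else (if q n then n else suc n))
  ≡⟨ least-suc q n ⟨
    least q (suc n) ∎
  where open ≡-Reasoning

UpwardClosed : (ℕ → Bool) → Set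
UpwardClosed p = ∀ {h k} → h ≤ k → T (p h) → T (p k)

count-below-false : ∀ {p} → UpwardClosed p → ∀ n → ¬ T (p (suc n)) → count p n ≡ 0
count-below-false up n ¬p = count-none n (λ h≤n → ¬p ∘ up (m≤n⇒m≤1+n h≤n))

least+count : ∀ (p : ℕ → Bool) → ¬ T (p 0) → UpwardClosed p →
              ∀ n → least p (suc n) + count p n ≡ suc n
least+count p ¬p0 up zero = cong (_+ 0) (trans (least-suc p 0) (if-¬T ¬p0))
least+count p ¬p0 up (suc n) rewrite least-suc p (suc n)
  with least+count p ¬p0 up n
     | least p (suc n) <ᵇ suc n | <ᵇ-reflects-< (least p (suc n)) (suc n)
     | p (suc n) in pn
... | ih | true  | ofʸ _   | true  = trans (+-suc _ _) (cong suc ih)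
... | ih | false | ofⁿ L≮n | true  =
  trans (+-suc (suc n) (count p n)) (cong suc (trans (cong (suc n +_) count≡0) (+-identityʳ (suc n))))
  where
  count≡0 : count p n ≡ 0
  count≡0 = n≤0⇒n≡0 (+-cancelˡ-≤ (suc n) _ _ (begin
    suc n + count p n            ≤⟨ +-monoˡ-≤ (count p n) (≮⇒≥ L≮n) ⟩
    least p (suc n) + count p n  ≡⟨ ih ⟩
    suc n                        ≡⟨ +-identityʳ (suc n) ⟨
    suc n + 0                    ∎))
    where open ≤-Reasoning
... | ih | true  | ofʸ L<n | false = contradiction L<n (≤⇒≯ (≤-reflexive (sym L≡)))
  where
  L≡ : least p (suc n) ≡ suc n
  L≡ = trans (sym (+-identityʳ _))
             (trans (cong (least p (suc n) +_) (sym (count-below-false up n (subst T pn)))) ih)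
... | ih | false | ofⁿ _   | false =
  trans (cong (suc (suc n) +_) (count-below-false up n (subst T pn))) (+-identityʳ _)

m+n≡o⇒m≡o∸n : ∀ {m n o} → m + n ≡ o → m ≡ o ∸ n
m+n≡o⇒m≡o∸n {m} {n} eq = trans (sym (m+n∸n≡m m n)) (cong (_∸ n) eq)

≤-suc⇒mono : ∀ (g : ℕ → ℕ) → (∀ n → g n ≤ g (suc n)) → ∀ {m n} → m ≤ n → g m ≤ g n
≤-suc⇒mono g step {n = zero}  z≤n = ≤-refl
≤-suc⇒mono g step {n = suc n} m≤1+n with m≤n⇒m<n∨m≡n m≤1+n
... | inj₁ (s≤s m≤n) = ≤-trans (≤-suc⇒mono g step m≤n) (step n)
... | inj₂ refl      = ≤-refl

entry≡diagonal : ∀ (t : ℕ → ℕ → ℕ) → (∀ {n i} → i ≤ n → t (suc n) i ≡ t n i) →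
                 ∀ {n i} → i ≤ n → t n i ≡ t i i
entry≡diagonal t stable {zero}  z≤n = refl
entry≡diagonal t stable {suc n} i≤1+n with m≤n⇒m<n∨m≡n i≤1+n
... | inj₁ (s≤s i≤n) = trans (stable i≤n) (entry≡diagonal t stable i≤n)
... | inj₂ refl      = refl

reach : ℕ → ℕ → ℕ
reach a h = suc a * h ∸ indeg a h

module _ (a : ℕ) where

  reaches : ℕ → ℕ → Bool
  reaches N h = N ≤ᵇ reach a h

  indegTable≡indeg : ∀ {n i} → i ≤ n → indegTable a n i ≡ indeg a i
  indegTable≡indeg = entry≡diagonal (indegTable a) (if-T ∘ ≤⇒≤ᵇ)

  indeg-suc : ∀ n → indeg a (suc n) ≡ count (reaches (suc n)) n
  indeg-suc n = trans (if-¬T (1+n≰ᵇn n))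
    (count-cong n (λ h≤n → cong (λ d → suc n ≤ᵇ (suc a * _ ∸ d)) (indegTable≡indeg h≤n)))

  indeg-≤ : ∀ n → indeg a n ≤ n
  indeg-≤ zero    = z≤n
  indeg-≤ (suc n) = m≤n⇒m≤1+n (subst (_≤ n) (sym (indeg-suc n)) (count-≤ _ n))

  reaches-pred : ∀ N h → T (reaches (suc N) h) → T (reaches N h)
  reaches-pred N h = ≤⇒≤ᵇ ∘ <⇒≤ ∘ ≤ᵇ⇒≤ (suc N) (reach a h)

  indeg-suc-≤ : ∀ n → indeg a (suc n) ≤ suc (indeg a n)
  indeg-suc-≤ zero    = z≤n
  indeg-suc-≤ (suc n) = begin
    indeg a (suc (suc n))                    ≡⟨ indeg-suc (suc n) ⟩
    count (reaches (suc (suc n))) (suc n)    ≤⟨ count-suc-≤ (reaches (suc (suc n))) n ⟩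
    suc (count (reaches (suc (suc n))) n)    ≤⟨ s≤s (count-mono _ _ (reaches-pred (suc n)) n) ⟩
    suc (count (reaches (suc n)) n)          ≡⟨ cong suc (indeg-suc n) ⟨
    suc (indeg a (suc n))                    ∎
    where open ≤-Reasoning

  reach-≡ : ∀ h → reach a h ≡ a * h + (h ∸ indeg a h)
  reach-≡ h = trans (+-∸-comm (a * h) (indeg-≤ h)) (+-comm (h ∸ indeg a h) (a * h))

  reach-suc : ∀ h → a + reach a h ≤ reach a (suc h)
  reach-suc h = begin
    a + reach a h                            ≡⟨ cong (a +_) (reach-≡ h) ⟩
    a + (a * h + (h ∸ indeg a h))            ≡⟨ +-assoc a (a * h) _ ⟨
    (a + a * h) + (h ∸ indeg a h)            ≡⟨ cong (_+ (h ∸ indeg a h)) (*-suc a h) ⟨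
    a * suc h + (suc h ∸ suc (indeg a h))    ≤⟨ +-monoʳ-≤ (a * suc h) (∸-monoʳ-≤ (suc h) (indeg-suc-≤ h)) ⟩
    a * suc h + (suc h ∸ indeg a (suc h))    ≡⟨ reach-≡ (suc h) ⟨
    reach a (suc h)                          ∎
    where open ≤-Reasoning

  reach-mono : ∀ {h k} → h ≤ k → reach a h ≤ reach a k
  reach-mono = ≤-suc⇒mono (reach a) (λ h → ≤-trans (m≤n+m (reach a h) a) (reach-suc h))

  reach-strict : 1 ≤ a → ∀ h → reach a h < reach a (suc h)
  reach-strict 1≤a h = <-≤-trans (m<n+m (reach a h) 1≤a) (reach-suc h)

  reaches-upward-closed : ∀ N → UpwardClosed (reaches N)
  reaches-upward-closed N {h} h≤k = ≤⇒≤ᵇ ∘ (λ le → ≤-trans le (reach-mono h≤k)) ∘ ≤ᵇ⇒≤ N (reach a h)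

  reaches-suc : 1 ≤ a → ∀ N h → T (reaches N h) → T (reaches (suc N) (suc h))
  reaches-suc 1≤a N h = ≤⇒≤ᵇ ∘ (λ le → ≤-<-trans le (reach-strict 1≤a h)) ∘ ≤ᵇ⇒≤ N (reach a h)

  indeg-≤-indeg-suc : 1 ≤ a → ∀ n → indeg a n ≤ indeg a (suc n)
  indeg-≤-indeg-suc 1≤a zero    = z≤n
  indeg-≤-indeg-suc 1≤a (suc n) = begin
    indeg a (suc n)                            ≡⟨ indeg-suc n ⟩
    count (reaches (suc n)) n                  ≤⟨ count-mono _ _ (reaches-suc 1≤a (suc n)) n ⟩
    count (reaches (suc (suc n)) ∘ suc) n      ≤⟨ count-shift (reaches (suc (suc n))) n ⟩
    count (reaches (suc (suc n))) (suc n)      ≡⟨ indeg-suc (suc n) ⟨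
    indeg a (suc (suc n))                      ∎
    where open ≤-Reasoning

  indeg-suc≡ : 1 ≤ a → ∀ n → indeg a (suc n) ≡ indeg a n ⊎ indeg a (suc n) ≡ suc (indeg a n)
  indeg-suc≡ 1≤a n with m≤n⇒m<n∨m≡n (indeg-≤-indeg-suc 1≤a n)
  ... | inj₁ grows = inj₂ (≤-antisym (indeg-suc-≤ n) grows)
  ... | inj₂ same  = inj₁ (sym same)

  Arc⇒≤reach : ∀ {i k} → Arc a i k → k ≤ reach a i
  Arc⇒≤reach {i} {k} arc =
    ≤ᵇ⇒≤ k (reach a i) (proj₂ (to (T-∧ {i <ᵇ k}) (proj₂ (to (T-∧ {1 ≤ᵇ i}) (from T-≡ arc)))))

  ≤reach⇒Arc : ∀ {i k} → 1 ≤ i → i < k → k ≤ reach a i → Arc a i k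
  ≤reach⇒Arc 1≤i i<k k≤reach =
    cong₂ _∧_ (to T-≡ (≤⇒≤ᵇ 1≤i)) (cong₂ _∧_ (to T-≡ (<⇒<ᵇ i<k)) (to T-≡ (≤⇒≤ᵇ k≤reach)))

  Arc-later : ∀ i j k → Arc a i k → i < j → j < k → Arc a j k
  Arc-later i j k arc i<j j<k =
    ≤reach⇒Arc {j} (≤-trans (s≤s z≤n) i<j) j<k (≤-trans (Arc⇒≤reach {i} arc) (reach-mono (<⇒≤ i<j)))

  outdeg≡reach∸ : ∀ m → outdeg a (suc m) ≡ reach a (suc m) ∸ suc m
  outdeg≡reach∸ m =
    trans (count-∧-≤ᵇ (suc m <ᵇ_) (suc a * suc m) (m∸n≤m (suc a * suc m) (indeg a (suc m))))
          (count-<ᵇ (suc m) (reach a (suc m)))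

  cTable≡c : ∀ {n i} → i ≤ n → cTable a n i ≡ c a i
  cTable≡c = entry≡diagonal (cTable a) (if-T ∘ ≤⇒≤ᵇ)

  c+indeg≡ : ∀ n → c a n + indeg a n ≡ n
  c+indeg≡ = <-rec _ step
    where
    step : ∀ n → (∀ {k} → k < n → c a k + indeg a k ≡ k) → c a n + indeg a n ≡ n
    step zero          _  = refl
    step (suc zero)    _  = refl
    step (suc (suc m)) ih = begin
        c a (suc N) + indeg a (suc N)
      ≡⟨ cong₂ _+_ (trans (if-¬T (1+n≰ᵇn N)) (least-cong (suc N) (cong (suc N ≤ᵇ_) ∘ a*k+c≡reach)))
                   (indeg-suc N) ⟩
        least (reaches (suc N)) (suc N) + count (reaches (suc N)) N
      ≡⟨ least+count (reaches (suc N)) ¬reaches-from-0 (reaches-upward-closed (suc N)) N ⟩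
        suc N ∎
      where
      open ≡-Reasoning
      N = suc m
      ¬reaches-from-0 : ¬ T (reaches (suc N) 0)
      ¬reaches-from-0 t = contradiction (≤-trans (≤ᵇ⇒≤ (suc N) _ t) (≤-reflexive (*-zeroʳ a))) λ ()
      a*k+c≡reach : ∀ {k} → k < suc N → a * k + cTable a N k ≡ reach a k
      a*k+c≡reach {k} k<1+N = begin
          a * k + cTable a N k          ≡⟨ cong (a * k +_) (cTable≡c (≤-pred k<1+N)) ⟩
          a * k + c a k                 ≡⟨ cong (a * k +_) (m+n≡o⇒m≡o∸n (ih k<1+N)) ⟩
          a * k + (k ∸ indeg a k)       ≡⟨ reach-≡ k ⟨
          reach a k                     ∎

outdeg≡ : ∀ a n → 1 ≤ a → 1 ≤ n → outdeg a n ≡ (a ∸ 1) * n + c a n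
outdeg≡ (suc b) (suc m) _ _ = begin
    outdeg a n                                 ≡⟨ outdeg≡reach∸ a m ⟩
    reach a n ∸ n                              ≡⟨ cong (_∸ n) (reach-≡ a n) ⟩
    ((n + b * n) + (n ∸ indeg a n)) ∸ n        ≡⟨ cong (_∸ n) (+-assoc n (b * n) _) ⟩
    (n + (b * n + (n ∸ indeg a n))) ∸ n        ≡⟨ m+n∸m≡n n _ ⟩
    b * n + (n ∸ indeg a n)                    ≡⟨ cong (b * n +_) (m+n≡o⇒m≡o∸n (c+indeg≡ a n)) ⟨
    b * n + c a n                              ∎
  where
  open ≡-Reasoning
  a = suc b
  n = suc m

outdeg+indeg≡ : ∀ a n → 1 ≤ a → 1 ≤ n → outdeg a n + indeg a n ≡ a * n
outdeg+indeg≡ (suc b) (suc m) 1≤a 1≤n = begin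
    outdeg a n + indeg a n                 ≡⟨ cong (_+ indeg a n) (outdeg≡ a n 1≤a 1≤n) ⟩
    (b * n + c a n) + indeg a n            ≡⟨ +-assoc (b * n) (c a n) (indeg a n) ⟩
    b * n + (c a n + indeg a n)            ≡⟨ cong (b * n +_) (c+indeg≡ a n) ⟩
    b * n + n                              ≡⟨ +-comm (b * n) n ⟩
    a * n                                  ∎
  where
  open ≡-Reasoning
  a = suc b
  n = suc m

lemma1p1 : (a : ℕ) → 1 ≤ a → (n : ℕ) → 1 ≤ n →
    (outdeg a n + indeg a n ≡ a * n)
    × (indeg a (suc n) ≡ indeg a n ⊎ indeg a (suc n) ≡ suc (indeg a n))
    × (∀ i j k → Arc a i k → i < j → j < k → Arc a j k)
    × (outdeg a n ≡ (a ∸ 1) * n + c a n)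
lemma1p1 a 1≤a n 1≤n =
  outdeg+indeg≡ a n 1≤a 1≤n , indeg-suc≡ a 1≤a n , Arc-later a , outdeg≡ a n 1≤a 1≤n
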